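{- For all integers $k,i\ge 1$, a graph $G$ has a proper $(2k+i,k+i,i)$-coloring if and only if it has a proper $(2k+i,k,0)$-coloring.
   Context: All graphs are finite, simple and undirected. A proper $(q,k,i)$-coloring of $G=(V,E)$ is a map $f:V\to\binom{[q]}{k}$ (each vertex gets a $k$-element subset of $[q]=\{1,\dots,q\}$) with $|f(u)\cap f(v)|\le i$ for every edge $\{u,v\}$. -}

module Defs where

open import Data.Nat using (ℕ; _≤_)
open import Data.Fin using (Fin)
open import Data.Fin.Subset using (Subset; ∣_∣; _∩_)
open import Data.Product using (Σ; _×_)
open import Relation.Binary.PropositionalEquality using (_≡_)
open import Relation.Nullary using (¬_)
open import Level using (0ℓ)

record Graph : Set₁ where
  field
    n        : ℕ
    Adj      : Fin n → Fin n → Set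
    Adj-sym  : ∀ {u v} → Adj u v → Adj v u
    Adj-irr  : ∀ {u} → ¬ Adj u u

open Graph public

KSubset : ℕ → ℕ → Set
KSubset q k = Σ (Subset q) (λ s → ∣ s ∣ ≡ k)

IsProperColoring : (G : Graph) (q k i : ℕ) → (Fin (n G) → KSubset q k) → Set
IsProperColoring G q k i f =
  ∀ u v → Adj G u v → ∣ Data.Product.proj₁ (f u) ∩ Data.Product.proj₁ (f v) ∣ ≤ i

HasProperColoring : (G : Graph) (q k i : ℕ) → Set
HasProperColoring G q k i =
  Σ (Fin (n G) → KSubset q k) (IsProperColoring G q k i)

-- By inclusion–exclusion, |∁P ∩ ∁Q| = q − |P| − |Q| + |P ∩ Q| for P, Q ⊆ [q]. With q = 2k+i,
-- complementation swaps (k+i)-sets and k-sets, and for (k+i)-sets the identity reads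
-- |∁P ∩ ∁Q| = |P ∩ Q| − i, for k-sets |∁P ∩ ∁Q| = |P ∩ Q| + i. So complementing every colour
-- turns a proper (2k+i, k+i, i)-colouring into a proper (2k+i, k, 0)-colouring and back.
module Submission where

open import Defs
open import Data.Nat using (ℕ; _≤_; _+_; _*_; suc)
open import Data.Nat.Properties
open import Data.Nat.Tactic.RingSolver using (solve-∀)
open import Data.Product using (_×_; _,_; proj₁; proj₂)
open import Data.Vec using ([]; _∷_)
open import Data.Bool using (true; false)
open import Data.Fin.Subset using (Subset; ∣_∣; _∩_; _∪_; ∁)
open import Data.Fin.Subset.Properties using (∣∁p∣≡n∸∣p∣; ∣p∣≤n; ∪-∩-booleanAlgebra)
open import Algebra.Lattice.Properties.BooleanAlgebra using (deMorgan₂)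
open import Relation.Binary.PropositionalEquality
open import Function using (_∘_)

∣p∪q∣+∣p∩q∣≡∣p∣+∣q∣ : ∀ {n} (p q : Subset n) → ∣ p ∪ q ∣ + ∣ p ∩ q ∣ ≡ ∣ p ∣ + ∣ q ∣
∣p∪q∣+∣p∩q∣≡∣p∣+∣q∣ [] [] = refl
∣p∪q∣+∣p∩q∣≡∣p∣+∣q∣ (true ∷ p) (true ∷ q) = cong suc (begin
  ∣ p ∪ q ∣ + suc ∣ p ∩ q ∣   ≡⟨ +-suc _ _ ⟩
  suc (∣ p ∪ q ∣ + ∣ p ∩ q ∣) ≡⟨ cong suc (∣p∪q∣+∣p∩q∣≡∣p∣+∣q∣ p q) ⟩
  suc (∣ p ∣ + ∣ q ∣)         ≡⟨ +-suc _ _ ⟨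
  ∣ p ∣ + suc ∣ q ∣           ∎)
  where open ≡-Reasoning
∣p∪q∣+∣p∩q∣≡∣p∣+∣q∣ (true ∷ p) (false ∷ q) = cong suc (∣p∪q∣+∣p∩q∣≡∣p∣+∣q∣ p q)
∣p∪q∣+∣p∩q∣≡∣p∣+∣q∣ (false ∷ p) (true ∷ q) =
  trans (cong suc (∣p∪q∣+∣p∩q∣≡∣p∣+∣q∣ p q)) (sym (+-suc _ _))
∣p∪q∣+∣p∩q∣≡∣p∣+∣q∣ (false ∷ p) (false ∷ q) = ∣p∪q∣+∣p∩q∣≡∣p∣+∣q∣ p q

∣∁p∣+∣p∣≡n : ∀ {n} (p : Subset n) → ∣ ∁ p ∣ + ∣ p ∣ ≡ n
∣∁p∣+∣p∣≡n p = trans (cong (_+ ∣ p ∣) (∣∁p∣≡n∸∣p∣ p)) (m∸n+n≡m (∣p∣≤n p))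

∣∁p∩∁q∣+∣p∣+∣q∣≡n+∣p∩q∣ : ∀ {n} (p q : Subset n) →
                          ∣ ∁ p ∩ ∁ q ∣ + (∣ p ∣ + ∣ q ∣) ≡ n + ∣ p ∩ q ∣
∣∁p∩∁q∣+∣p∣+∣q∣≡n+∣p∩q∣ {n} p q = begin
  ∣ ∁ p ∩ ∁ q ∣ + (∣ p ∣ + ∣ q ∣)               ≡⟨ cong₂ _+_ ∣∁[p∪q]∣≡∣∁p∩∁q∣ (∣p∪q∣+∣p∩q∣≡∣p∣+∣q∣ p q) ⟨
  ∣ ∁ (p ∪ q) ∣ + (∣ p ∪ q ∣ + ∣ p ∩ q ∣)       ≡⟨ +-assoc (∣ ∁ (p ∪ q) ∣) (∣ p ∪ q ∣) (∣ p ∩ q ∣) ⟨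
  ∣ ∁ (p ∪ q) ∣ + ∣ p ∪ q ∣ + ∣ p ∩ q ∣         ≡⟨ cong (_+ ∣ p ∩ q ∣) (∣∁p∣+∣p∣≡n (p ∪ q)) ⟩
  n + ∣ p ∩ q ∣                                 ∎
  where
  open ≡-Reasoning
  ∣∁[p∪q]∣≡∣∁p∩∁q∣ : ∣ ∁ (p ∪ q) ∣ ≡ ∣ ∁ p ∩ ∁ q ∣
  ∣∁[p∪q]∣≡∣∁p∩∁q∣ = cong ∣_∣ (deMorgan₂ (∪-∩-booleanAlgebra n) p q)

∣p∣≡a⇒∣∁p∣≡b : ∀ {n a b} (p : Subset n) → a + b ≡ n → ∣ p ∣ ≡ a → ∣ ∁ p ∣ ≡ b
∣p∣≡a⇒∣∁p∣≡b {n} {a} {b} p a+b≡n ∣p∣≡a = +-cancelʳ-≡ a (∣ ∁ p ∣) b (begin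
  ∣ ∁ p ∣ + a     ≡⟨ cong (∣ ∁ p ∣ +_) ∣p∣≡a ⟨
  ∣ ∁ p ∣ + ∣ p ∣ ≡⟨ ∣∁p∣+∣p∣≡n p ⟩
  n               ≡⟨ a+b≡n ⟨
  a + b           ≡⟨ +-comm a b ⟩
  b + a           ∎)
  where open ≡-Reasoning

∁-KSubset : ∀ {q a b} → a + b ≡ q → KSubset q a → KSubset q b
∁-KSubset a+b≡q (p , ∣p∣≡a) = ∁ p , ∣p∣≡a⇒∣∁p∣≡b p a+b≡q ∣p∣≡a

∣∁p∩∁q∣+a≡b+∣p∩q∣ : ∀ {n a b} (p q : Subset n) → a + b ≡ n → ∣ p ∣ ≡ a → ∣ q ∣ ≡ a →
                    ∣ ∁ p ∩ ∁ q ∣ + a ≡ b + ∣ p ∩ q ∣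
∣∁p∩∁q∣+a≡b+∣p∩q∣ {n} {a} {b} p q a+b≡n ∣p∣≡a ∣q∣≡a = +-cancelˡ-≡ a _ _ (begin
  a + (∣ ∁ p ∩ ∁ q ∣ + a)         ≡⟨ a+[x+a]≡x+[a+a] a (∣ ∁ p ∩ ∁ q ∣) ⟩
  ∣ ∁ p ∩ ∁ q ∣ + (a + a)         ≡⟨ cong₂ (λ x y → ∣ ∁ p ∩ ∁ q ∣ + (x + y)) ∣p∣≡a ∣q∣≡a ⟨
  ∣ ∁ p ∩ ∁ q ∣ + (∣ p ∣ + ∣ q ∣) ≡⟨ ∣∁p∩∁q∣+∣p∣+∣q∣≡n+∣p∩q∣ p q ⟩
  n + ∣ p ∩ q ∣                   ≡⟨ cong (_+ ∣ p ∩ q ∣) a+b≡n ⟨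
  a + b + ∣ p ∩ q ∣               ≡⟨ +-assoc a b (∣ p ∩ q ∣) ⟩
  a + (b + ∣ p ∩ q ∣)             ∎)
  where
  open ≡-Reasoning
  a+[x+a]≡x+[a+a] : ∀ a x → a + (x + a) ≡ x + (a + a)
  a+[x+a]≡x+[a+a] = solve-∀

complement-coloring : ∀ {G q a b j j′} → a + b ≡ q → b + j ≤ j′ + a →
                      HasProperColoring G q a j → HasProperColoring G q b j′
complement-coloring {G} {q} {a} {b} {j} {j′} a+b≡q b+j≤j′+a (f , proper) =
  ∁-KSubset a+b≡q ∘ f , proper′
  where
  proper′ : IsProperColoring G q b j′ (∁-KSubset a+b≡q ∘ f)
  proper′ u v uv = +-cancelʳ-≤ a _ _ (begin
    ∣ ∁ p ∩ ∁ p′ ∣ + a ≡⟨ ∣∁p∩∁q∣+a≡b+∣p∩q∣ p p′ a+b≡q (proj₂ (f u)) (proj₂ (f v)) ⟩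
    b + ∣ p ∩ p′ ∣     ≤⟨ +-monoʳ-≤ b (proper u v uv) ⟩
    b + j              ≤⟨ b+j≤j′+a ⟩
    j′ + a             ∎)
    where
    open ≤-Reasoning
    p p′ : Subset q
    p  = proj₁ (f u)
    p′ = proj₁ (f v)

lemma4 : (k i : ℕ) → 1 ≤ k → 1 ≤ i → (G : Graph) →
         (HasProperColoring G (2 * k + i) (k + i) i → HasProperColoring G (2 * k + i) k 0)
         × (HasProperColoring G (2 * k + i) k 0 → HasProperColoring G (2 * k + i) (k + i) i)
lemma4 k i _ _ G =
  complement-coloring {G} (k+i+k≡2k+i k i) ≤-refl ,
  complement-coloring {G} (k+[k+i]≡2k+i k i) (≤-reflexive (k+i+0≡i+k k i))
  where
  k+i+k≡2k+i : ∀ k i → k + i + k ≡ 2 * k + i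
  k+i+k≡2k+i = solve-∀
  k+[k+i]≡2k+i : ∀ k i → k + (k + i) ≡ 2 * k + i
  k+[k+i]≡2k+i = solve-∀
  k+i+0≡i+k : ∀ k i → k + i + 0 ≡ i + k
  k+i+0≡i+k = solve-∀
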